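{- Every proof in $\mathsf{LNGL}$ can be transformed into a proof in normal form.
   Context: A linear nested sequent is $\Gamma_{1} \vdash \Delta_{1} \mathbin{/\!/} \cdots \mathbin{/\!/} \Gamma_{n} \vdash \Delta_{n}$ with formula multisets $\Gamma_i,\Delta_i$ (formulae built from atoms by $\neg,\lor,\Box$). The calculus $\mathsf{LNGL}$ has rules ($\mathcal{G}$ a possibly empty prefix): $\mathsf{id_1}$: $\mathcal{G} \mathbin{/\!/} \Gamma, p \vdash p, \Delta$; $\mathsf{id_2}$: $\mathcal{G} \mathbin{/\!/} \Gamma, \Box\phi \vdash \Box\phi, \Delta$; local rules $\lor\mathsf{L}$: from $\mathcal{G} \mathbin{/\!/} \Gamma, \phi \vdash \Delta$ and $\mathcal{G} \mathbin{/\!/} \Gamma, \psi \vdash \Delta$ infer $\mathcal{G} \mathbin{/\!/} \Gamma, \phi\lor\psi \vdash \Delta$; $\lor\mathsf{R}$: from $\mathcal{G} \mathbin{/\!/} \Gamma \vdash \phi,\psi,\Delta$ infer $\mathcal{G} \mathbin{/\!/} \Gamma \vdash \phi\lor\psi,\Delta$; $\neg\mathsf{L}$: from $\mathcal{G} \mathbin{/\!/} \Gamma \vdash \phi,\Delta$ infer $\mathcal{G} \mathbin{/\!/} \Gamma,\neg\phi \vdash \Delta$; $\neg\mathsf{R}$: from $\mathcal{G} \mathbin{/\!/} \Gamma,\phi \vdash \Delta$ infer $\mathcal{G} \mathbin{/\!/} \Gamma \vdash \neg\phi,\Delta$; propagation rules $\mathsf{4L}$: from $\mathcal{G} \mathbin{/\!/}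 \Gamma,\Box\phi \vdash \Delta \mathbin{/\!/} \Sigma,\Box\phi \vdash \Pi$ infer $\mathcal{G} \mathbin{/\!/} \Gamma,\Box\phi \vdash \Delta \mathbin{/\!/} \Sigma \vdash \Pi$; $\Box\mathsf{L}$: from $\mathcal{G} \mathbin{/\!/} \Gamma,\Box\phi \vdash \Delta \mathbin{/\!/} \Sigma,\phi \vdash \Pi$ infer $\mathcal{G} \mathbin{/\!/} \Gamma,\Box\phi \vdash \Delta \mathbin{/\!/} \Sigma \vdash \Pi$; and $\Box\mathsf{R}$: from $\mathcal{G} \mathbin{/\!/} \Gamma \vdash \Delta \mathbin{/\!/} \Box\phi \vdash \phi$ infer $\mathcal{G} \mathbin{/\!/} \Gamma \vdash \Box\phi,\Delta$. A block is a derivation using only rules from a given set. An $\mathsf{LNGL}$ proof is in normal form iff, reading bottom-up, each $\Box\mathsf{R}$ application with premise $\mathcal{G} \mathbin{/\!/} \Gamma \vdash \Delta \mathbin{/\!/} \Box\phi \vdash \phi$ has that premise derived by a block of $\mathsf{4L}$ rules from some $\mathcal{G} \mathbin{/\!/} \Gamma \vdash \Delta \mathbin{/\!/} \Gamma', \Box\phi \vdash \phi$, which is derived by a block of $\Box\mathsf{L}$ rules from some $\mathcal{G} \mathbin{/\!/} \Gamma \vdash \Delta \mathbin{/\!/} \Gamma', \Gamma'', \Box\phi \vdash \phi$, which is derived by a block of local rules from premises of the form $\mathcal{G} \mathbin{/\!/} \Gamma \vdash \Delta \mathbin{/\!/} \Sigma_i \vdash \Pi_i$ (each of which is an initial sequent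 or the conclusion of a further $\Box\mathsf{R}$). -}

module Defs where

open import Data.Nat using (ℕ)
open import Data.List using (List; []; _∷_; _++_)
open import Data.List.Membership.Propositional using (_∈_)
open import Data.List.Relation.Binary.Permutation.Propositional using (_↭_)
open import Data.Product using (Σ)

data Fm : Set where
  at  : ℕ → Fm
  ¬′_ : Fm → Fm
  _∨′_ : Fm → Fm → Fm
  □_  : Fm → Fm

-- Sequents Γ ⊢ Δ with multisets represented as lists; multiset equality
-- is permutation (_↭_).  "Γ , φ" in a conclusion is rendered as a list
-- Γ' with Γ' ↭ φ ∷ Γ; a formula that is kept in the context of both
-- premise and conclusion is rendered by membership.

record Seq : Set where
  constructor _⊢_
  field
    ant : List Fm
    suc : List Fm

-- Possibly empty prefix 𝒢 of a linear nested sequent (snoc list,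
-- components left to right).
data Pre : Set where
  ε   : Pre
  _▸_ : Pre → Seq → Pre

data LNS : Set where
  _//_ : Pre → Seq → LNS

infixl 5 _▸_
infix 3 _//_
infix 4 _⊢_

data Proof : LNS → Set where
  id₁ : ∀ {G Γ Δ} p → at p ∈ Γ → at p ∈ Δ → Proof (G // Γ ⊢ Δ)
  id₂ : ∀ {G Γ Δ} φ → (□ φ) ∈ Γ → (□ φ) ∈ Δ → Proof (G // Γ ⊢ Δ)
  ∨L : ∀ {G Γ Γ₀ Δ} φ ψ → Γ ↭ (φ ∨′ ψ) ∷ Γ₀ →
       Proof (G // φ ∷ Γ₀ ⊢ Δ) → Proof (G // ψ ∷ Γ₀ ⊢ Δ) →
       Proof (G // Γ ⊢ Δ)
  ∨R : ∀ {G Γ Δ Δ₀} φ ψ → Δ ↭ (φ ∨′ ψ) ∷ Δ₀ →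
       Proof (G // Γ ⊢ φ ∷ ψ ∷ Δ₀) →
       Proof (G // Γ ⊢ Δ)
  ¬L : ∀ {G Γ Γ₀ Δ} φ → Γ ↭ (¬′ φ) ∷ Γ₀ →
       Proof (G // Γ₀ ⊢ φ ∷ Δ) →
       Proof (G // Γ ⊢ Δ)
  ¬R : ∀ {G Γ Δ Δ₀} φ → Δ ↭ (¬′ φ) ∷ Δ₀ →
       Proof (G // φ ∷ Γ ⊢ Δ₀) →
       Proof (G // Γ ⊢ Δ)
  4L : ∀ {G Γ Δ Σ Π} φ → (□ φ) ∈ Γ →
       Proof (G ▸ (Γ ⊢ Δ) // (□ φ) ∷ Σ ⊢ Π) →
       Proof (G ▸ (Γ ⊢ Δ) // Σ ⊢ Π)
  □L : ∀ {G Γ Δ Σ Π} φ → (□ φ) ∈ Γ →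
       Proof (G ▸ (Γ ⊢ Δ) // φ ∷ Σ ⊢ Π) →
       Proof (G ▸ (Γ ⊢ Δ) // Σ ⊢ Π)
  □R : ∀ {G Γ Δ Δ₀} φ → Δ ↭ (□ φ) ∷ Δ₀ →
       Proof (G ▸ (Γ ⊢ Δ₀) // (□ φ) ∷ [] ⊢ φ ∷ []) →
       Proof (G // Γ ⊢ Δ)

-- NF d      : every □R application in d has a premise of shape
--               (block of 4L) over (block of □L) over (block of local
--               rules) whose leaves are initial sequents or conclusions
--               of further □R applications (again in normal form).

data NF     : ∀ {S} → Proof S → Set
data Blk4   : ∀ {S} → Proof S → Set
data Blk□L  : ∀ {S} → Proof S → Set
data BlkLoc : ∀ {S} → Proof S → Set

data NF where
  id₁ : ∀ {G Γ Δ p a b} → NF (id₁ {G} {Γ} {Δ} p a b)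
  id₂ : ∀ {G Γ Δ φ a b} → NF (id₂ {G} {Γ} {Δ} φ a b)
  ∨L : ∀ {G Γ Γ₀ Δ φ ψ e d₁ d₂} → NF d₁ → NF d₂ →
       NF (∨L {G} {Γ} {Γ₀} {Δ} φ ψ e d₁ d₂)
  ∨R : ∀ {G Γ Δ Δ₀ φ ψ e d} → NF d → NF (∨R {G} {Γ} {Δ} {Δ₀} φ ψ e d)
  ¬L : ∀ {G Γ Γ₀ Δ φ e d} → NF d → NF (¬L {G} {Γ} {Γ₀} {Δ} φ e d)
  ¬R : ∀ {G Γ Δ Δ₀ φ e d} → NF d → NF (¬R {G} {Γ} {Δ} {Δ₀} φ e d)
  4L : ∀ {G Γ Δ Σ Π φ m d} → NF d → NF (4L {G} {Γ} {Δ} {Σ} {Π} φ m d)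
  □L : ∀ {G Γ Δ Σ Π φ m d} → NF d → NF (□L {G} {Γ} {Δ} {Σ} {Π} φ m d)
  □R : ∀ {G Γ Δ Δ₀ φ e d} → Blk4 d → NF (□R {G} {Γ} {Δ} {Δ₀} φ e d)

data Blk4 where
  4L   : ∀ {G Γ Δ Σ Π φ m d} → Blk4 d → Blk4 (4L {G} {Γ} {Δ} {Σ} {Π} φ m d)
  done : ∀ {S} {d : Proof S} → Blk□L d → Blk4 d

data Blk□L where
  □L   : ∀ {G Γ Δ Σ Π φ m d} → Blk□L d → Blk□L (□L {G} {Γ} {Δ} {Σ} {Π} φ m d)
  done : ∀ {S} {d : Proof S} → BlkLoc d → Blk□L d

data BlkLoc where
  ∨L : ∀ {G Γ Γ₀ Δ φ ψ e d₁ d₂} → BlkLoc d₁ → BlkLoc d₂ →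
       BlkLoc (∨L {G} {Γ} {Γ₀} {Δ} φ ψ e d₁ d₂)
  ∨R : ∀ {G Γ Δ Δ₀ φ ψ e d} → BlkLoc d → BlkLoc (∨R {G} {Γ} {Δ} {Δ₀} φ ψ e d)
  ¬L : ∀ {G Γ Γ₀ Δ φ e d} → BlkLoc d → BlkLoc (¬L {G} {Γ} {Γ₀} {Δ} φ e d)
  ¬R : ∀ {G Γ Δ Δ₀ φ e d} → BlkLoc d → BlkLoc (¬R {G} {Γ} {Δ} {Δ₀} φ e d)
  id₁ : ∀ {G Γ Δ p a b} → BlkLoc (id₁ {G} {Γ} {Δ} p a b)
  id₂ : ∀ {G Γ Δ φ a b} → BlkLoc (id₂ {G} {Γ} {Δ} φ a b)
  □R : ∀ {G Γ Δ Δ₀ φ e d} → Blk4 d → BlkLoc (□R {G} {Γ} {Δ} {Δ₀} φ e d)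

InNormalForm : ∀ {S} → Proof S → Set
InNormalForm = NF

-- Propagation rules read only the second-to-last component, which local rules
-- never change. So inside the premise of a □R, every 4L and □L can be permuted
-- below the local rules. To do this, collect the formulas they introduce, add
-- them to every sequent of the remaining local derivation by weakening (which
-- preserves the shape of derivations), and reintroduce them at the bottom:
-- first the □L formulas, then below them the boxed 4L formulas. Premises of
-- □R inside that local derivation are normalised recursively.
{-# OPTIONS --safe #-}
module Submission where

open import Defs
open import Data.Product using (Σ; Σ-syntax; _,_)
open import Data.List using (List; []; _∷_; _++_; map)
open import Data.List.Membership.Propositional using (_∈_)
open import Data.List.Relation.Binary.Subset.Propositional using (_⊆_)
open import Data.List.Relation.Binary.Subset.Propositional.Properties
  using (⊆-refl; ⊆-respʳ-↭; xs⊆ys++xs)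
open import Data.List.Relation.Unary.All using (All; []; _∷_)
open import Data.List.Relation.Unary.All.Properties using () renaming (++⁺ to All-++⁺)
open import Data.List.Relation.Binary.Permutation.Propositional
open import Data.List.Relation.Binary.Permutation.Propositional.Properties
  using (++⁺ˡ; ++⁺ʳ; ++-assoc; shift; shifts)

↭-++⇒⊆ : ∀ {Γ Γ' : List Fm} X → Γ' ↭ X ++ Γ → Γ ⊆ Γ'
↭-++⇒⊆ {Γ} X p = ⊆-respʳ-↭ (↭-sym p) (xs⊆ys++xs Γ X)

prep-shift : ∀ {Γ Γ' : List Fm} a {X} → Γ' ↭ X ++ Γ → a ∷ Γ' ↭ X ++ a ∷ Γ
prep-shift a {X} p = ↭-trans (prep a p) (↭-sym (shift a X _))

extend-principal : ∀ {Γ Γ' Γ₀ : List Fm} {a} X → Γ' ↭ X ++ Γ → Γ ↭ a ∷ Γ₀ → Γ' ↭ a ∷ X ++ Γ₀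
extend-principal {a = a} X p e = ↭-trans p (↭-trans (++⁺ˡ X e) (shift a X _))

-- Weakening has to enlarge prefix antecedents too: a □R moves the last
-- component into the prefix.
infix 4 _≼_
data _≼_ : Pre → Pre → Set where
  ε   : ε ≼ ε
  _▸_ : ∀ {G G' Γ Γ' Δ} → G ≼ G' → Γ ⊆ Γ' → G ▸ (Γ ⊢ Δ) ≼ G' ▸ (Γ' ⊢ Δ)

≼-refl : ∀ G → G ≼ G
≼-refl ε             = ε
≼-refl (G ▸ (Γ ⊢ Δ)) = ≼-refl G ▸ ⊆-refl

weaken : ∀ {G G' Γ Γ' Δ} X → G ≼ G' → Γ' ↭ X ++ Γ → Proof (G // Γ ⊢ Δ) → Proof (G' // Γ' ⊢ Δ)
weaken X _ p (id₁ q a b)          = id₁ q (↭-++⇒⊆ X p a) b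
weaken X _ p (id₂ φ a b)          = id₂ φ (↭-++⇒⊆ X p a) b
weaken X G≼G' p (∨L φ ψ e d₁ d₂)  =
  ∨L φ ψ (extend-principal X p e) (weaken X G≼G' (prep-shift φ ↭-refl) d₁)
                                  (weaken X G≼G' (prep-shift ψ ↭-refl) d₂)
weaken X G≼G' p (∨R φ ψ e d)      = ∨R φ ψ e (weaken X G≼G' p d)
weaken X G≼G' p (¬L φ e d)        = ¬L φ (extend-principal X p e) (weaken X G≼G' ↭-refl d)
weaken X G≼G' p (¬R φ e d)        = ¬R φ e (weaken X G≼G' (prep-shift φ p) d)
weaken X (G≼G' ▸ Γ⊆Γ') p (4L φ m d) = 4L φ (Γ⊆Γ' m) (weaken X (G≼G' ▸ Γ⊆Γ') (prep-shift (□ φ) p) d)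
weaken X (G≼G' ▸ Γ⊆Γ') p (□L φ m d) = □L φ (Γ⊆Γ' m) (weaken X (G≼G' ▸ Γ⊆Γ') (prep-shift φ p) d)
weaken X G≼G' p (□R φ e d)        = □R φ e (weaken [] (G≼G' ▸ ↭-++⇒⊆ X p) ↭-refl d)

weaken-Blk4   : ∀ {G G' Γ Γ' Δ} X (G≼G' : G ≼ G') (p : Γ' ↭ X ++ Γ) {d : Proof (G // Γ ⊢ Δ)} →
                Blk4 d → Blk4 (weaken X G≼G' p d)
weaken-Blk□L  : ∀ {G G' Γ Γ' Δ} X (G≼G' : G ≼ G') (p : Γ' ↭ X ++ Γ) {d : Proof (G // Γ ⊢ Δ)} →
                Blk□L d → Blk□L (weaken X G≼G' p d)
weaken-BlkLoc : ∀ {G G' Γ Γ' Δ} X (G≼G' : G ≼ G') (p : Γ' ↭ X ++ Γ) {d : Proof (G // Γ ⊢ Δ)} →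
                BlkLoc d → BlkLoc (weaken X G≼G' p d)

weaken-Blk4 X (G≼G' ▸ Γ⊆Γ') p (4L b) = 4L (weaken-Blk4 X (G≼G' ▸ Γ⊆Γ') _ b)
weaken-Blk4 X G≼G' p (done b)         = done (weaken-Blk□L X G≼G' p b)

weaken-Blk□L X (G≼G' ▸ Γ⊆Γ') p (□L b) = □L (weaken-Blk□L X (G≼G' ▸ Γ⊆Γ') _ b)
weaken-Blk□L X G≼G' p (done b)         = done (weaken-BlkLoc X G≼G' p b)

weaken-BlkLoc X G≼G' p (∨L b₁ b₂) = ∨L (weaken-BlkLoc X G≼G' _ b₁) (weaken-BlkLoc X G≼G' _ b₂)
weaken-BlkLoc X G≼G' p (∨R b)     = ∨R (weaken-BlkLoc X G≼G' p b)
weaken-BlkLoc X G≼G' p (¬L b)     = ¬L (weaken-BlkLoc X G≼G' _ b)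
weaken-BlkLoc X G≼G' p (¬R b)     = ¬R (weaken-BlkLoc X G≼G' _ b)
weaken-BlkLoc X _ p id₁           = id₁
weaken-BlkLoc X _ p id₂           = id₂
weaken-BlkLoc X G≼G' p (□R b)     = □R (weaken-Blk4 [] _ ↭-refl b)

exchange : ∀ {G Θ Θ' Π} → Θ' ↭ Θ → Proof (G // Θ ⊢ Π) → Proof (G // Θ' ⊢ Π)
exchange = weaken [] (≼-refl _)

exchange-BlkLoc : ∀ {G Θ Θ' Π} (p : Θ' ↭ Θ) {d : Proof (G // Θ ⊢ Π)} → BlkLoc d → BlkLoc (exchange p d)
exchange-BlkLoc = weaken-BlkLoc [] (≼-refl _)

data Propagated (Γ : List Fm) : Fm → Set where
  by4L : ∀ {φ} → □ φ ∈ Γ → Propagated Γ (□ φ)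
  by□L : ∀ {φ} → □ φ ∈ Γ → Propagated Γ φ

record SplitByRule (Γ E : List Fm) : Set where
  constructor split
  field
    □L-bodies 4L-bodies : List Fm
    □L-ok : All (λ φ → □ φ ∈ Γ) □L-bodies
    4L-ok : All (λ φ → □ φ ∈ Γ) 4L-bodies
    arrangement : E ↭ □L-bodies ++ map □_ 4L-bodies

splitByRule : ∀ {Γ E} → All (Propagated Γ) E → SplitByRule Γ E
splitByRule [] = split [] [] [] [] ↭-refl
splitByRule (by4L m ∷ ps) with splitByRule ps
... | split B F B-ok F-ok arr = split B (_ ∷ F) B-ok (m ∷ F-ok) (prep-shift _ arr)
splitByRule (by□L m ∷ ps) with splitByRule ps
... | split B F B-ok F-ok arr = split (_ ∷ B) F (m ∷ B-ok) F-ok (prep _ arr)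

close□L : ∀ {G Γ Δ Θ Π} B → All (λ φ → □ φ ∈ Γ) B →
          (d : Proof (G ▸ (Γ ⊢ Δ) // B ++ Θ ⊢ Π)) → Blk□L d →
          Σ[ d' ∈ Proof (G ▸ (Γ ⊢ Δ) // Θ ⊢ Π) ] Blk□L d'
close□L []      []       d b = d , b
close□L (φ ∷ B) (m ∷ ms) d b = close□L B ms (□L φ m d) (□L b)

close4L : ∀ {G Γ Δ Θ Π} F → All (λ φ → □ φ ∈ Γ) F →
          (d : Proof (G ▸ (Γ ⊢ Δ) // map □_ F ++ Θ ⊢ Π)) → Blk4 d →
          Σ[ d' ∈ Proof (G ▸ (Γ ⊢ Δ) // Θ ⊢ Π) ] Blk4 d'
close4L []      []       d b = d , b
close4L (φ ∷ F) (m ∷ ms) d b = close4L F ms (4L φ m d) (4L b)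

record Localised (G : Pre) (Γ Δ Θ Π : List Fm) : Set where
  constructor localised
  field
    {added}    : List Fm
    propagated : All (Propagated Γ) added
    derivation : Proof (G ▸ (Γ ⊢ Δ) // added ++ Θ ⊢ Π)
    isLocal    : BlkLoc derivation

localise : ∀ {G Γ Δ Θ Π} → Proof (G ▸ (Γ ⊢ Δ) // Θ ⊢ Π) → Localised G Γ Δ Θ Π
toBlk4   : ∀ {G Γ Δ Θ Π} → Proof (G ▸ (Γ ⊢ Δ) // Θ ⊢ Π) →
           Σ[ d ∈ Proof (G ▸ (Γ ⊢ Δ) // Θ ⊢ Π) ] Blk4 d

localise (id₁ q a b) = localised [] (id₁ q a b) id₁
localise (id₂ φ a b) = localised [] (id₂ φ a b) id₂
localise (∨L {Γ₀ = Θ₀} φ ψ e d₁ d₂) with localise d₁ | localise d₂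
... | localised {E₁} ok₁ p₁ l₁ | localised {E₂} ok₂ p₂ l₂ =
  localised (All-++⁺ ok₁ ok₂)
            (∨L φ ψ (extend-principal (E₁ ++ E₂) ↭-refl e)
                (weaken E₂ (≼-refl _) q₁ p₁) (weaken E₁ (≼-refl _) q₂ p₂))
            (∨L (weaken-BlkLoc E₂ _ q₁ l₁) (weaken-BlkLoc E₁ _ q₂ l₂))
  where
  q₂ : ψ ∷ (E₁ ++ E₂) ++ Θ₀ ↭ E₁ ++ E₂ ++ ψ ∷ Θ₀
  q₂ = ↭-trans (prep-shift ψ ↭-refl) (++-assoc E₁ E₂ _)
  q₁ : φ ∷ (E₁ ++ E₂) ++ Θ₀ ↭ E₂ ++ E₁ ++ φ ∷ Θ₀
  q₁ = ↭-trans (↭-trans (prep-shift φ ↭-refl) (++-assoc E₁ E₂ _)) (shifts E₁ E₂)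
localise (∨R φ ψ e d) with localise d
... | localised ok p l = localised ok (∨R φ ψ e p) (∨R l)
localise (¬L φ e d) with localise d
... | localised {E} ok p l = localised ok (¬L φ (extend-principal E ↭-refl e) p) (¬L l)
localise (¬R φ e d) with localise d
... | localised ok p l = localised ok (¬R φ e (exchange (prep-shift φ ↭-refl) p)) (¬R (exchange-BlkLoc _ l))
localise (4L φ m d) with localise d
... | localised ok p l = localised (by4L m ∷ ok) (exchange (prep-shift (□ φ) ↭-refl) p) (exchange-BlkLoc _ l)
localise (□L φ m d) with localise d
... | localised ok p l = localised (by□L m ∷ ok) (exchange (prep-shift φ ↭-refl) p) (exchange-BlkLoc _ l)
localise (□R φ e d) with toBlk4 d
... | d' , b = localised [] (□R φ e d') (□R b)

toBlk4 {Θ = Θ} d with localise d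
... | localised {E} ok p l with splitByRule ok
... | split B F B-ok F-ok arr =
  let d□ , b□ = close□L B B-ok (exchange sorted p) (done (exchange-BlkLoc sorted l))
  in  close4L F F-ok d□ (done b□)
  where
  sorted : B ++ map □_ F ++ Θ ↭ E ++ Θ
  sorted = ↭-trans (↭-sym (++-assoc B _ Θ)) (++⁺ʳ Θ (↭-sym arr))

normalise : ∀ {S} → Proof S → Σ (Proof S) NF
normalise (id₁ q a b) = id₁ q a b , id₁
normalise (id₂ φ a b) = id₂ φ a b , id₂
normalise (∨L φ ψ e d₁ d₂) with normalise d₁ | normalise d₂
... | d₁' , n₁ | d₂' , n₂ = ∨L φ ψ e d₁' d₂' , ∨L n₁ n₂
normalise (∨R φ ψ e d) with normalise d
... | d' , n = ∨R φ ψ e d' , ∨R n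
normalise (¬L φ e d) with normalise d
... | d' , n = ¬L φ e d' , ¬L n
normalise (¬R φ e d) with normalise d
... | d' , n = ¬R φ e d' , ¬R n
normalise (4L φ m d) with normalise d
... | d' , n = 4L φ m d' , 4L n
normalise (□L φ m d) with normalise d
... | d' , n = □L φ m d' , □L n
normalise (□R φ e d) with toBlk4 d
... | d' , b = □R φ e d' , □R b

theorem4p10 : ∀ (S : LNS) → Proof S → Σ (Proof S) InNormalForm
theorem4p10 S = normalise
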